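{- Every 1-dimensional Murai sphere $\mathrm{Bier}_c(M)$ (i.e. with $c\in\mathbb N^m$, $|c|=3$, and $M$ a proper $c$-multicomplex) is isomorphic to the boundary of a triangle, a square, a pentagon, or a hexagon.
   Context: Fix $m\geq1$ and $c=(c_1,\ldots,c_m)$ with all $c_i\geq1$ integers; $|c|=c_1+\cdots+c_m$. A $c$-monomial is $x^a=x_1^{a_1}\cdots x_m^{a_m}$ with $0\le a_i\le c_i$. A $c$-multicomplex is a nonempty set $M$ of $c$-monomials closed under taking divisors; it is proper if it is not the set of all $c$-monomials. Let $\tilde X=\{x_i^{(j)}: 1\le i\le m,\ 0\le j\le c_i\}$. For a $c$-monomial $x^a$, $1\le i\le m$ and $a_i<j\le c_i$, put $G(x^a;x_i^j)=\tilde X\setminus\{x_1^{(a_1)},\ldots,x_m^{(a_m)},x_i^{(j)}\}$ and let $x^a\diamond x_i^j$ be the monomial obtained from $x^a$ by replacing the exponent $a_i$ by $j$. For a proper $c$-multicomplex $M$, the Murai sphere $\mathrm{Bier}_c(M)$ is the simplicial complex on $\tilde X$ whose facets are the sets $G(x^a;x_i^j)$ with $x^a\in M$, $a_i<j\le c_i$ and $x^a\diamond x_i^j\notin M$. It is a simplicial sphere of dimension $|c|-2$. Elements of $\tilde X$ lying in no face (ghost vertices) are ignored when comparing complexes up to isomorphism. -}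

module Defs where

open import Data.Nat using (ℕ; zero; suc; _≤_; _<_; _%_)
open import Data.Nat.DivMod using (_mod_)
open import Data.Fin using (Fin; toℕ)
open import Data.Vec using (Vec; lookup; _[_]≔_)
open import Data.Bool using (Bool; true; false)
open import Data.Product using (Σ; Σ-syntax; ∃; _×_; _,_)
open import Relation.Nullary using (¬_)
open import Relation.Binary.PropositionalEquality using (_≡_; _≢_)
open import Function.Definitions using (Injective)

_≐_ : ∀ {V : Set} → (V → Set) → (V → Set) → Set
S ≐ T = ∀ v → (S v → T v) × (T v → S v)

image : ∀ {V W : Set} → (W → V) → (W → Set) → (V → Set)
image {W = W} f T v = Σ W λ w → T w × f w ≡ v

-- A (pure) simplicial complex presented by its set of facets.
FacetFamily : Set → Set₁
FacetFamily V = (V → Set) → Set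

-- K (on V, possibly with ghost vertices) is isomorphic to L (on W) when
-- L has no ghost vertices: an injective vertex map f : W → V such that the
-- facets of K are exactly the images of the facets of L.  (Then f is a
-- bijection from W onto the non-ghost vertices of K carrying facets to
-- facets, i.e. a simplicial isomorphism ignoring ghost vertices of K.)
_≅_ : ∀ {V W : Set} → FacetFamily V → FacetFamily W → Set₁
_≅_ {V} {W} K L =
  Σ (W → V) λ f → Injective _≡_ _≡_ f ×
    (∀ (S : V → Set) →
       (K S → Σ (W → Set) λ T → L T × (S ≐ image f T)) ×
       ((Σ (W → Set) λ T → L T × (S ≐ image f T)) → K S))

next : ∀ {n} → Fin n → Fin n
next {suc n} k = suc (toℕ k) mod (suc n)

PolygonBoundary : (n : ℕ) → FacetFamily (Fin n)
PolygonBoundary n S = Σ (Fin n) λ k → S ≐ (λ v → (v ≡ k) Data.Sum.⊎ (v ≡ next k))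
  where import Data.Sum

IsCMonomial : ∀ {m} → Vec ℕ m → Vec ℕ m → Set
IsCMonomial c a = ∀ i → lookup a i ≤ lookup c i

_∣ᵐ_ : ∀ {m} → Vec ℕ m → Vec ℕ m → Set
a ∣ᵐ b = ∀ i → lookup a i ≤ lookup b i

record IsProperMulticomplex {m} (c : Vec ℕ m) (M : Vec ℕ m → Bool) : Set where
  field
    onlyCMonomials : ∀ a → M a ≡ true → IsCMonomial c a
    nonempty       : Σ (Vec ℕ m) λ a → M a ≡ true
    divisorClosed  : ∀ a b → M b ≡ true → a ∣ᵐ b → M a ≡ true
    proper         : Σ (Vec ℕ m) λ a → IsCMonomial c a × M a ≡ false

-- vertex x_i^(j) is the pair (i , j); pairs with j > c_i lie in no facet
-- (they are ghost vertices).
Vertex : ℕ → Set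
Vertex m = Fin m × ℕ

-- G(x^a; x_i^j) = X̃ ∖ {x_1^(a_1),…,x_m^(a_m), x_i^(j)}
G : ∀ {m} → Vec ℕ m → Vec ℕ m → Fin m → ℕ → Vertex m → Set
G c a i j (k , l) = (l ≤ lookup c k) × (l ≢ lookup a k) × ¬ ((k ≡ i) × (l ≡ j))

Bier : ∀ {m} → Vec ℕ m → (Vec ℕ m → Bool) → FacetFamily (Vertex m)
Bier {m} c M S =
  Σ (Vec ℕ m) λ a → Σ (Fin m) λ i → Σ ℕ λ j →
    (M a ≡ true) × (lookup a i < j) × (j ≤ lookup c i) ×
    (M (a [ i ]≔ j) ≡ false) × (S ≐ G c a i j)

-- A positive c with |c| = 3 is one of the four compositions (3), (1,2),
-- (2,1), (1,1,1) of 3, and a c-multicomplex is determined by its values on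
-- the finitely many c-monomials, so the theorem is a finite check.  For each
-- c and M a cyclic sequence of vertices is found by an unverified search and
-- then certified, by evaluation, to be a polygon with 3 to 6 vertices whose
-- edges are exactly the facets of Bier_c(M); what is proved by hand is that
-- such a certificate yields the isomorphism.
module Submission where

open import Defs
open import Data.Nat using (ℕ; _≤_)
open import Data.Fin using (Fin)
open import Data.Vec using (Vec; lookup; sum)
open import Data.Bool using (Bool)
open import Data.Product using (Σ; _×_)
open import Data.Sum using (_⊎_)
open import Relation.Binary.PropositionalEquality using (_≡_)

open import Data.Bool using (true; false; if_then_else_; not; _∧_)
import Data.Bool.Properties as Boolₚ
open import Data.Fin using (zero; suc)
import Data.Fin.Properties as Finₚ
open import Data.List
  using (List; []; _∷_; [_]; _++_; map; concatMap; cartesianProductWith; upTo; allFin; filter; length)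
import Data.List as List
open import Data.List.Membership.Propositional using (_∈_; find; lose)
open import Data.List.Membership.Propositional.Properties
  using (∈-map⁺; ∈-++⁺ˡ; ∈-++⁺ʳ; ∈-concatMap⁺; ∈-concatMap⁻; ∈-cartesianProductWith⁺;
         ∈-cartesianProductWith⁻; ∈-upTo⁺; ∈-upTo⁻; ∈-allFin)
open import Data.List.Relation.Unary.All using (All; all?)
import Data.List.Relation.Unary.All as All
open import Data.List.Relation.Unary.Any using (Any; here; there; any?)
import Data.List.Relation.Unary.Any as Any
open import Data.Nat using (zero; suc; _<_; z≤n; s≤s; _≤?_; _<?_)
import Data.Nat.Properties as ℕₚ
open import Data.Product using (_,_; proj₁; proj₂)
import Data.Product.Properties as Productₚ
open import Data.Sum using (inj₁; inj₂; [_,_]′)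
open import Data.Unit using (tt)
open import Data.Vec using ([]; _∷_; replicate; _[_]≔_)
import Data.Vec.Properties as Vecₚ
open import Function using (_∘_)
open import Relation.Binary using (DecidableEquality)
open import Relation.Binary.PropositionalEquality using (refl; sym; trans)
open import Relation.Nullary using (Dec; yes; no; ¬_; does; contradiction)
open import Relation.Nullary.Decidable using (_×-dec_; _⊎-dec_; ¬?; _→-dec_; map′; toWitness)

_≟ᵥ_ : ∀ {m} → DecidableEquality (Vertex m)
_≟ᵥ_ = Productₚ.≡-dec Finₚ._≟_ ℕₚ._≟_

_≟ₘ_ : ∀ {m} → DecidableEquality (Vec ℕ m)
_≟ₘ_ = Vecₚ.≡-dec ℕₚ._≟_

module _ {V : Set} where

  ≐-refl : {S : V → Set} → S ≐ S
  ≐-refl v = (λ s → s) , (λ s → s)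

  ≐-sym : {S T : V → Set} → S ≐ T → T ≐ S
  ≐-sym S≐T v = proj₂ (S≐T v) , proj₁ (S≐T v)

  ≐-trans : {S T U : V → Set} → S ≐ T → T ≐ U → S ≐ U
  ≐-trans S≐T T≐U v = proj₁ (T≐U v) ∘ proj₁ (S≐T v) , proj₂ (S≐T v) ∘ proj₂ (T≐U v)

  _≐_on_ : (V → Set) → (V → Set) → List V → Set
  S ≐ T on vs = All (λ v → (S v → T v) × (T v → S v)) vs

  ≐-on⇒≐ : {S T : V → Set} (vs : List V) → (∀ {v} → S v → v ∈ vs) → (∀ {v} → T v → v ∈ vs) →
           S ≐ T on vs → S ≐ T
  ≐-on⇒≐ vs S⊆vs T⊆vs S≐T v = (λ s → proj₁ (All.lookup S≐T (S⊆vs s)) s) ,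
                              (λ t → proj₂ (All.lookup S≐T (T⊆vs t)) t)

Edge : ∀ {V : Set} → V → V → V → Set
Edge u w v = v ≡ u ⊎ v ≡ w

module _ {V W : Set} (f : W → V) where

  image-cong : {S T : W → Set} → S ≐ T → image f S ≐ image f T
  image-cong S≐T v = (λ (w , s , fw≡v) → w , proj₁ (S≐T w) s , fw≡v) ,
                     (λ (w , t , fw≡v) → w , proj₂ (S≐T w) t , fw≡v)

  image-Edge : ∀ x y → image f (Edge x y) ≐ Edge (f x) (f y)
  image-Edge x y v = to , from
    where
    to : image f (Edge x y) v → Edge (f x) (f y) v
    to (_ , inj₁ refl , refl) = inj₁ refl
    to (_ , inj₂ refl , refl) = inj₂ refl
    from : Edge (f x) (f y) v → image f (Edge x y) v
    from (inj₁ refl) = x , inj₁ refl , refl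
    from (inj₂ refl) = y , inj₂ refl , refl

monomials : ∀ {m} → Vec ℕ m → List (Vec ℕ m)
monomials []      = [ [] ]
monomials (x ∷ c) = cartesianProductWith _∷_ (upTo (suc x)) (monomials c)

∈-monomials⁺ : ∀ {m} (c : Vec ℕ m) {a} → IsCMonomial c a → a ∈ monomials c
∈-monomials⁺ []      {[]}    _   = here refl
∈-monomials⁺ (x ∷ c) {y ∷ a} a≤c =
  ∈-cartesianProductWith⁺ _∷_ {xs = upTo (suc x)} (∈-upTo⁺ (s≤s (a≤c zero))) (∈-monomials⁺ c (a≤c ∘ suc))

∈-monomials⁻ : ∀ {m} (c : Vec ℕ m) {a : Vec ℕ m} → a ∈ monomials c → IsCMonomial c a
∈-monomials⁻ (x ∷ c) a∈
  with _ , _ , y∈ , a′∈ , refl ← ∈-cartesianProductWith⁻ _∷_ (upTo (suc x)) (monomials c) a∈ =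
  λ { zero → ℕₚ.≤-pred (∈-upTo⁻ y∈) ; (suc i) → ∈-monomials⁻ c a′∈ i }

vertices : ∀ {m} → Vec ℕ m → List (Vertex m)
vertices {m} c = concatMap (λ k → map (k ,_) (upTo (suc (lookup c k)))) (allFin m)

∈-vertices⁺ : ∀ {m} (c : Vec ℕ m) {k l} → l ≤ lookup c k → (k , l) ∈ vertices c
∈-vertices⁺ c {k} l≤ = ∈-concatMap⁺ _ (lose (∈-allFin k) (∈-map⁺ (k ,_) (∈-upTo⁺ (s≤s l≤))))

-- A label (a , i , j) stands for the pair (x^a , x_i^j) indexing the facet G(x^a ; x_i^j).
Label : ℕ → Set
Label m = Vec ℕ m × Fin m × ℕ

labelsAt : ∀ {m} → Vec ℕ m → Fin m → List (Label m)
labelsAt c i = cartesianProductWith (λ a j → a , i , j) (monomials c) (upTo (suc (lookup c i)))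

labels : ∀ {m} → Vec ℕ m → List (Label m)
labels {m} c = concatMap (labelsAt c) (allFin m)

∈-labels⁺ : ∀ {m} (c a : Vec ℕ m) {i j} → IsCMonomial c a → j ≤ lookup c i → (a , i , j) ∈ labels c
∈-labels⁺ c a {i} a≤c j≤ =
  ∈-concatMap⁺ _ (lose (∈-allFin i)
    (∈-cartesianProductWith⁺ (λ a j → a , i , j) (∈-monomials⁺ c a≤c) (∈-upTo⁺ (s≤s j≤))))

∈-labels⁻ : ∀ {m} (c : Vec ℕ m) {a i j} → (a , i , j) ∈ labels c → IsCMonomial c a × j ≤ lookup c i
∈-labels⁻ c ∈labels with i , _ , ∈product ← find (∈-concatMap⁻ (labelsAt c) {xs = allFin _} ∈labels)
                   with _ , _ , a∈ , j∈ , refl ← ∈-cartesianProductWith⁻ (λ a j → a , i , j) _ _ ∈product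
  = ∈-monomials⁻ c a∈ , ℕₚ.≤-pred (∈-upTo⁻ j∈)

[]≔-isCMonomial : ∀ {m} (c a : Vec ℕ m) (i : Fin m) {j} →
                  IsCMonomial c a → j ≤ lookup c i → IsCMonomial c (a [ i ]≔ j)
[]≔-isCMonomial (_ ∷ _) (_ ∷ _) zero    a≤c j≤ zero    = j≤
[]≔-isCMonomial (_ ∷ _) (_ ∷ _) zero    a≤c j≤ (suc k) = a≤c (suc k)
[]≔-isCMonomial (_ ∷ _) (_ ∷ _) (suc i) a≤c j≤ zero    = a≤c zero
[]≔-isCMonomial (_ ∷ c) (_ ∷ a) (suc i) a≤c j≤ (suc k) = []≔-isCMonomial c a i (a≤c ∘ suc) j≤ k

Exit : ∀ {m} → (Vec ℕ m → Bool) → Label m → Set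
Exit M (a , i , j) = (M a ≡ true) × (lookup a i < j) × (M (a [ i ]≔ j) ≡ false)

exit? : ∀ {m} (M : Vec ℕ m → Bool) (t : Label m) → Dec (Exit M t)
exit? M (a , i , j) = (M a Boolₚ.≟ true) ×-dec (lookup a i <? j) ×-dec (M (a [ i ]≔ j) Boolₚ.≟ false)

exit-transfer : ∀ {m} (c : Vec ℕ m) {M M′ : Vec ℕ m → Bool} →
                (∀ a → IsCMonomial c a → M a ≡ M′ a) →
                ∀ {t} → t ∈ labels c → Exit M t → Exit M′ t
exit-transfer c agree {a , i , j} t∈ (Ma , a<j , Ma′) =
  trans (sym (agree a a≤c)) Ma , a<j , trans (sym (agree _ ([]≔-isCMonomial c a i a≤c j≤))) Ma′
  where
  a≤c = proj₁ (∈-labels⁻ c t∈)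
  j≤  = proj₂ (∈-labels⁻ c t∈)

G? : ∀ {m} (c a : Vec ℕ m) i j (v : Vertex m) → Dec (G c a i j v)
G? c a i j (k , l) =
  (l ≤? lookup c k) ×-dec ¬? (l ℕₚ.≟ lookup a k) ×-dec ¬? ((k Finₚ.≟ i) ×-dec (l ℕₚ.≟ j))

edge? : ∀ {m} (u w v : Vertex m) → Dec (Edge u w v)
edge? u w v = (v ≟ᵥ u) ⊎-dec (v ≟ᵥ w)

FacetIsEdge : ∀ {m} → Vec ℕ m → Label m → Vertex m → Vertex m → Set
FacetIsEdge c (a , i , j) u w = G c a i j ≐ Edge u w on vertices c

facetIsEdge? : ∀ {m} (c : Vec ℕ m) t u w → Dec (FacetIsEdge c t u w)
facetIsEdge? c (a , i , j) u w =
  all? (λ v → (G? c a i j v →-dec edge? u w v) ×-dec (edge? u w v →-dec G? c a i j v)) (vertices c)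

record PolygonCertificate {m} (c : Vec ℕ m) (M : Vec ℕ m → Bool) {n} (f : Fin n → Vertex m) : Set where
  field
    injective      : All (λ x → All (λ y → f x ≡ f y → x ≡ y) (allFin n)) (allFin n)
    nonGhost       : All (λ x → f x ∈ vertices c) (allFin n)
    facetsAreEdges : All (λ t → Exit M t → Any (λ k → FacetIsEdge c t (f k) (f (next k))) (allFin n))
                         (labels c)
    edgesAreFacets : All (λ k → Any (λ t → Exit M t × FacetIsEdge c t (f k) (f (next k))) (labels c))
                         (allFin n)

polygonCertificate? : ∀ {m} (c : Vec ℕ m) M {n} (f : Fin n → Vertex m) → Dec (PolygonCertificate c M f)
polygonCertificate? c M {n} f =
  map′ (λ (p , q , r , s) → record { injective = p ; nonGhost = q ; facetsAreEdges = r ; edgesAreFacets = s })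
       (λ cert → let open PolygonCertificate cert in injective , nonGhost , facetsAreEdges , edgesAreFacets)
       (all? (λ x → all? (λ y → (f x ≟ᵥ f y) →-dec (x Finₚ.≟ y)) (allFin n)) (allFin n)
        ×-dec all? (λ x → any? (f x ≟ᵥ_) (vertices c)) (allFin n)
        ×-dec all? (λ t → exit? M t →-dec any? (λ k → facetIsEdge? c t (f k) (f (next k))) (allFin n))
                   (labels c)
        ×-dec all? (λ k → any? (λ t → exit? M t ×-dec facetIsEdge? c t (f k) (f (next k))) (labels c))
                   (allFin n))

-- The certificate is computed for a finite table M′, which only agrees with M on c-monomials.
certificate⇒≅ : ∀ {m} {c : Vec ℕ m} {M M′ : Vec ℕ m → Bool} → IsProperMulticomplex c M →
                (∀ a → IsCMonomial c a → M′ a ≡ M a) →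
                ∀ {n} {f : Fin n → Vertex m} → PolygonCertificate c M′ f → Bier c M ≅ PolygonBoundary n
certificate⇒≅ {c = c} {M} pm agree {n} {f} cert = f , f-injective , λ S → bier⇒polygon S , polygon⇒bier S
  where
  open PolygonCertificate cert
  open IsProperMulticomplex pm

  f-injective : ∀ {x y} → f x ≡ f y → x ≡ y
  f-injective {x} {y} = All.lookup (All.lookup injective (∈-allFin x)) (∈-allFin y)

  facet≐edge : ∀ a i j k → FacetIsEdge c (a , i , j) (f k) (f (next k)) →
               G c a i j ≐ Edge (f k) (f (next k))
  facet≐edge a i j k = ≐-on⇒≐ (vertices c) (λ g → ∈-vertices⁺ c (proj₁ g)) endpoint∈
    where
    endpoint∈ : ∀ {v} → Edge (f k) (f (next k)) v → v ∈ vertices c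
    endpoint∈ (inj₁ refl) = All.lookup nonGhost (∈-allFin k)
    endpoint∈ (inj₂ refl) = All.lookup nonGhost (∈-allFin (next k))

  polygon≐ : ∀ k → image f (Edge k (next k)) ≐ Edge (f k) (f (next k))
  polygon≐ k = image-Edge f k (next k)

  bier⇒polygon : ∀ S → Bier c M S → Σ (Fin n → Set) λ T → PolygonBoundary n T × (S ≐ image f T)
  bier⇒polygon S (a , i , j , Ma , a<j , j≤ , Ma′ , S≐G) =
    Edge k (next k) , (k , ≐-refl) , ≐-trans S≐G (≐-trans (facet≐edge a i j k G≐edge) (≐-sym (polygon≐ k)))
    where
    t∈ = ∈-labels⁺ c a {i} (onlyCMonomials a Ma) j≤
    exit = exit-transfer c (λ b b≤c → sym (agree b b≤c)) t∈ (Ma , a<j , Ma′)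
    k = proj₁ (Any.satisfied (All.lookup facetsAreEdges t∈ exit))
    G≐edge = proj₂ (Any.satisfied (All.lookup facetsAreEdges t∈ exit))

  polygon⇒bier : ∀ S → (Σ (Fin n → Set) λ T → PolygonBoundary n T × (S ≐ image f T)) → Bier c M S
  polygon⇒bier S (T , (k , T≐edge) , S≐fT) with find (All.lookup edgesAreFacets (∈-allFin k))
  ... | (a , i , j) , t∈ , exit , G≐edge with Ma , a<j , Ma′ ← exit-transfer c agree t∈ exit =
    a , i , j , Ma , a<j , proj₂ (∈-labels⁻ c t∈) , Ma′ ,
    ≐-trans S≐fT (≐-trans (image-cong f T≐edge) (≐-trans (polygon≐ k) (≐-sym (facet≐edge a i j k G≐edge))))

-- Unverified: walks along the facets, treated as edges of a graph, from
-- the first one.  Only the certificate check on its result is trusted.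
module CycleSearch {m} (c : Vec ℕ m) (M : Vec ℕ m → Bool) where

  edges : List (List (Vertex m))
  edges = map (λ (a , i , j) → filter (G? c a i j) (vertices c)) (filter (exit? M) (labels c))

  _==_ : Vertex m → Vertex m → Bool
  u == v = does (u ≟ᵥ v)

  neighbourAvoiding : Vertex m → Vertex m → List (List (Vertex m)) → Vertex m
  neighbourAvoiding previous current [] = current
  neighbourAvoiding previous current ((u ∷ w ∷ _) ∷ es) =
    if u == current ∧ not (w == previous) then w
    else if w == current ∧ not (u == previous) then u
    else neighbourAvoiding previous current es
  neighbourAvoiding previous current (_ ∷ es) = neighbourAvoiding previous current es

  walk : ℕ → Vertex m → Vertex m → Vertex m → List (Vertex m)
  walk zero       start previous current = []
  walk (suc fuel) start previous current =
    if current == start then []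
    else current ∷ walk fuel start current (neighbourAvoiding previous current edges)

  cycle : List (Vertex m)
  cycle with edges
  ... | (u ∷ w ∷ _) ∷ _ = u ∷ walk (length edges) u u w
  ... | _               = []

SmallPolygon : ∀ {m} → Vec ℕ m → (Vec ℕ m → Bool) → Set
SmallPolygon c M = (n ≡ 3 ⊎ n ≡ 4 ⊎ n ≡ 5 ⊎ n ≡ 6) × PolygonCertificate c M (List.lookup cycle)
  where
  open CycleSearch c M
  n = length cycle

smallPolygon? : ∀ {m} (c : Vec ℕ m) M → Dec (SmallPolygon c M)
smallPolygon? c M =
  (n ℕₚ.≟ 3 ⊎-dec n ℕₚ.≟ 4 ⊎-dec n ℕₚ.≟ 5 ⊎-dec n ℕₚ.≟ 6) ×-dec polygonCertificate? c M (List.lookup cycle)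
  where
  open CycleSearch c M
  n = length cycle

-- The necessary conditions on a multicomplex that are visible on c-monomials.
IsProperDownSet : ∀ {m} → Vec ℕ m → (Vec ℕ m → Bool) → Set
IsProperDownSet {m} c M =
  (M (replicate m 0) ≡ true) × (M c ≡ false) ×
  All (λ b → All (λ a → a ∣ᵐ b → M b ≡ true → M a ≡ true) (monomials c)) (monomials c)

_∣ᵐ?_ : ∀ {m} (a b : Vec ℕ m) → Dec (a ∣ᵐ b)
a ∣ᵐ? b = Finₚ.all? (λ i → lookup a i ≤? lookup b i)

isProperDownSet? : ∀ {m} (c : Vec ℕ m) M → Dec (IsProperDownSet c M)
isProperDownSet? {m} c M =
  (M (replicate m 0) Boolₚ.≟ true) ×-dec (M c Boolₚ.≟ false) ×-dec
  all? (λ b → all? (λ a → (a ∣ᵐ? b) →-dec (M b Boolₚ.≟ true) →-dec (M a Boolₚ.≟ true))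
                   (monomials c))
       (monomials c)

1∣ᵐ : ∀ {m} (a : Vec ℕ m) → replicate m 0 ∣ᵐ a
1∣ᵐ a i = ℕₚ.≤-trans (ℕₚ.≤-reflexive (Vecₚ.lookup-replicate i 0)) z≤n

proper⇒top∉ : ∀ {m} {c : Vec ℕ m} {M} → IsProperMulticomplex c M → M c ≡ false
proper⇒top∉ {c = c} pm = Boolₚ.¬-not λ Mc → Boolₚ.not-¬ (divisorClosed a c Mc a∣c) Ma
  where
  open IsProperMulticomplex pm
  a   = proj₁ proper
  a∣c = proj₁ (proj₂ proper)
  Ma  = proj₂ (proj₂ proper)

proper⇒isProperDownSet : ∀ {m} {c : Vec ℕ m} {M M′} → IsProperMulticomplex c M →
                         (∀ a → IsCMonomial c a → M′ a ≡ M a) → IsProperDownSet c M′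
proper⇒isProperDownSet {c = c} pm agree =
  trans (agree _ (1∣ᵐ c)) M1 ,
  trans (agree c (λ _ → ℕₚ.≤-refl)) (proper⇒top∉ pm) ,
  All.tabulate λ {b} b∈ → All.tabulate λ {a} a∈ a∣b M′b →
    trans (agree a (∈-monomials⁻ c a∈))
          (divisorClosed a b (trans (sym (agree b (∈-monomials⁻ c b∈))) M′b) a∣b)
  where
  open IsProperMulticomplex pm
  M1 = divisorClosed _ (proj₁ nonempty) (proj₂ nonempty) (1∣ᵐ (proj₁ nonempty))

module _ {A : Set} (_≟_ : DecidableEquality A) where

  fromTable : List A → List Bool → A → Bool
  fromTable (x ∷ xs) (b ∷ bs) a = if does (x ≟ a) then b else fromTable xs bs a
  fromTable _        _        _ = false

  fromTable-map : (g : A → Bool) {xs : List A} {a : A} → a ∈ xs → fromTable xs (map g xs) a ≡ g a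
  fromTable-map g {a = a} (here refl) with a ≟ a
  ... | yes _   = refl
  ... | no a≢a = contradiction refl a≢a
  fromTable-map g {x ∷ _} {a} (there a∈) with x ≟ a
  ... | yes refl = refl
  ... | no _     = fromTable-map g a∈

tables : ∀ {A : Set} → List A → List (List Bool)
tables []       = [ [] ]
tables (_ ∷ xs) = map (true ∷_) (tables xs) ++ map (false ∷_) (tables xs)

∈-tables : ∀ {A : Set} (g : A → Bool) (xs : List A) → map g xs ∈ tables xs
∈-tables g []       = here refl
∈-tables g (x ∷ xs) with g x
... | true  = ∈-++⁺ˡ (∈-map⁺ (true ∷_) (∈-tables g xs))
... | false = ∈-++⁺ʳ _ (∈-map⁺ (false ∷_) (∈-tables g xs))

AllBierSmallPolygons : ∀ {m} → Vec ℕ m → Set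
AllBierSmallPolygons c =
  All (λ bs → ¬ IsProperDownSet c (fromTable _≟ₘ_ (monomials c) bs) ⊎
              SmallPolygon c (fromTable _≟ₘ_ (monomials c) bs))
      (tables (monomials c))

allBierSmallPolygons? : ∀ {m} (c : Vec ℕ m) → Dec (AllBierSmallPolygons c)
allBierSmallPolygons? c =
  all? (λ bs → ¬? (isProperDownSet? c (fromTable _≟ₘ_ (monomials c) bs)) ⊎-dec
               smallPolygon? c (fromTable _≟ₘ_ (monomials c) bs))
       (tables (monomials c))

allBierSmallPolygons⇒≅ : ∀ {m} {c : Vec ℕ m} → AllBierSmallPolygons c →
  (M : Vec ℕ m → Bool) → IsProperMulticomplex c M →
  Σ ℕ λ n → (n ≡ 3 ⊎ n ≡ 4 ⊎ n ≡ 5 ⊎ n ≡ 6) × (Bier c M ≅ PolygonBoundary n)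
allBierSmallPolygons⇒≅ {c = c} all-small M pm =
  [ contradiction (proper⇒isProperDownSet pm agree)
  , (λ (size , cert) → _ , size , certificate⇒≅ pm agree cert)
  ]′ (All.lookup all-small (∈-tables M (monomials c)))
  where
  agree : ∀ a → IsCMonomial c a → fromTable _≟ₘ_ (monomials c) (map M (monomials c)) a ≡ M a
  agree a a≤c = fromTable-map _≟ₘ_ M (∈-monomials⁺ c a≤c)

Composition : Set
Composition = Σ ℕ (Vec ℕ)

-- Compositions of s+1 arise from those of s by prepending a part 1 or by
-- incrementing the first part.
compositions : ℕ → List Composition
compositions zero    = [ 0 , [] ]
compositions (suc s) = map prependOne (compositions s) ++ concatMap incrementHead (compositions s)
  where
  prependOne : Composition → Composition
  prependOne (m , c) = suc m , 1 ∷ c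
  incrementHead : Composition → List Composition
  incrementHead (zero  , [])    = []
  incrementHead (suc m , x ∷ c) = [ suc m , suc x ∷ c ]

∈-compositions : ∀ s {m} (c : Vec ℕ m) → (∀ i → 1 ≤ lookup c i) → sum c ≡ s → (m , c) ∈ compositions s
∈-compositions _       (zero ∷ c)        pos _  = contradiction (pos zero) λ ()
∈-compositions zero    []                pos _  = here refl
∈-compositions (suc s) (suc zero ∷ c)    pos eq =
  ∈-++⁺ˡ (∈-map⁺ _ (∈-compositions s c (pos ∘ suc) (ℕₚ.suc-injective eq)))
∈-compositions (suc s) (suc (suc x) ∷ c) pos eq =
  ∈-++⁺ʳ _ (∈-concatMap⁺ _ (lose (∈-compositions s (suc x ∷ c) pos′ (ℕₚ.suc-injective eq)) (here refl)))
  where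
  pos′ : ∀ i → 1 ≤ lookup (suc x ∷ c) i
  pos′ zero    = s≤s z≤n
  pos′ (suc i) = pos (suc i)

compositions-of-3-smallPolygons : All (λ (_ , c) → AllBierSmallPolygons c) (compositions 3)
compositions-of-3-smallPolygons =
  toWitness {a? = all? (λ (_ , c) → allBierSmallPolygons? c) (compositions 3)} tt

mainTheorem2 : (m : ℕ) (c : Vec ℕ m) → (∀ i → 1 ≤ lookup c i) → sum c ≡ 3 →
    (M : Vec ℕ m → Bool) → IsProperMulticomplex c M →
    Σ ℕ λ n → (n ≡ 3 ⊎ n ≡ 4 ⊎ n ≡ 5 ⊎ n ≡ 6) × (Bier c M ≅ PolygonBoundary n)
mainTheorem2 m c pos sum≡3 =
  allBierSmallPolygons⇒≅ (All.lookup compositions-of-3-smallPolygons (∈-compositions 3 c pos sum≡3))
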